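{- Let $A,B,C,D\in\mathbb{Q}[t]$ with $B,C,D\ne0$, of degrees $s_a,s_b,s_c,s_d$ respectively (with $s_a=-\infty$ if $A=0$), and write $r_{b,s_b},r_{c,s_c},r_{d,s_d}$ for the leading coefficients of $B,C,D$. Assume $s_d=s_b+1$, $s_b>s_c$, $s_b\ge s_a$, and $d\,r_{d,s_d}\ne r_{b,s_b}$ for all $d\in\mathbb{N}$ with $0<d<2(s_b-s_c)$. Let $x\in\mathbb{Q}((t^{ -1}))$ be a solution of $Dx'=A+Bx+Cx^2$ with $\deg x\ge1$. Then $\deg x=s_b-s_c$ and the leading coefficient of $x$ equals $$\frac{r_{d,s_d}(s_b-s_c)-r_{b,s_b}}{r_{c,s_c}}.$$
   Context: $\mathbb{Q}((t^{ -1}))$ is the field of formal Laurent series $\sum_{k\ge -d}c_kt^{ -k}$, $c_k\in\mathbb{Q}$; the degree of a nonzero series is the largest $d$ with $c_{ -d}\ne0$, and $c_{ -d}$ is its leading coefficient; $'$ denotes $d/dt$. -}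

module Defs where

open import Data.Nat as ℕ using (ℕ; zero; suc)
open import Data.Integer as ℤ using (ℤ; +_; -[1+_])
open import Data.Rational as ℚ using (ℚ; 0ℚ; _/_)
open import Data.List using (List; []; _∷_)
open import Data.Product using (_×_)
open import Relation.Binary.PropositionalEquality using (_≡_; _≢_)

-- Formal Laurent series in t⁻¹ over ℚ are represented by their coefficient
-- function  f : ℤ → ℚ  (f n = coefficient of tⁿ), together with an integer
-- upper bound N such that f n ≡ 0 for all n > N.

ℤtoℚ : ℤ → ℚ
ℤtoℚ z = z / 1

trunc : ℤ → ℕ
trunc (+ k) = k
trunc -[1+ _ ] = 0

sumFrom : (ℤ → ℚ) → ℤ → ℕ → ℚ
sumFrom f lo zero = 0ℚ
sumFrom f lo (suc k) = f lo ℚ.+ sumFrom f (lo ℤ.+ + 1) k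

BoundedBy : (ℤ → ℚ) → ℤ → Set
BoundedBy f N = ∀ n → N ℤ.< n → f n ≡ 0ℚ

-- Cauchy product of Laurent series f (bounded by N) and g (bounded by M):
-- (fg)ₙ = Σ_{i = n-M}^{N} fᵢ g_{n-i}  (a finite sum; all other terms vanish).
-- The product is bounded by N + M.
mul : (ℤ → ℚ) → ℤ → (ℤ → ℚ) → ℤ → ℤ → ℚ
mul f N g M n =
  sumFrom (λ i → f i ℚ.* g (n ℤ.- i)) (n ℤ.- M) (trunc (N ℤ.+ M ℤ.- n ℤ.+ + 1))

deriv : (ℤ → ℚ) → ℤ → ℚ
deriv f n = ℤtoℚ (n ℤ.+ + 1) ℚ.* f (n ℤ.+ + 1)

IsDegree : (ℤ → ℚ) → ℤ → Set
IsDegree f d = (f d ≢ 0ℚ) × (∀ n → d ℤ.< n → f n ≡ 0ℚ)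

-- Polynomials in ℚ[t] as coefficient lists [p₀, p₁, …] (constant term first)
lookupℕ : List ℚ → ℕ → ℚ
lookupℕ [] _ = 0ℚ
lookupℕ (a ∷ _) zero = a
lookupℕ (_ ∷ as) (suc k) = lookupℕ as k

coeffP : List ℚ → ℤ → ℚ
coeffP p (+ k) = lookupℕ p k
coeffP p -[1+ _ ] = 0ℚ

-- Compare the top coefficients of both sides of D x' = A + B x + C x².  If x has
-- degree m ≥ 1 with leading coefficient ℓ, the left side and B x have degree at most
-- s_b + m with coefficients r_d m ℓ and r_b ℓ there, A does not reach that far, and
-- C x² has degree s_c + 2m with coefficient r_c ℓ².  If s_c + m > s_b, the term r_c ℓ²
-- is alone at the top, which is impossible; if s_c + m < s_b, then m r_d = r_b with
-- 0 < m < 2(s_b - s_c), excluded by hypothesis.  Hence m = s_b - s_c, and the top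
-- coefficients give r_d m ℓ = r_b ℓ + r_c ℓ², i.e. ℓ = (r_d m - r_b) / r_c.
module Submission where

open import Defs
open import Data.Nat as ℕ using (ℕ; zero; suc; _∸_; z≤n; s≤s)
import Data.Nat.Properties as ℕP
open import Data.Integer as ℤ using (ℤ; +_; -[1+_]; +≤+; +<+)
import Data.Integer.Properties as ℤP
open import Data.Integer.Solver using () renaming (module +-*-Solver to ℤ-Solver)
open import Data.Rational as ℚ using (ℚ; 0ℚ; 1ℚ; _÷_; ≢-nonZero; NonZero)
import Data.Rational.Properties as ℚP
open import Data.Rational.Solver using () renaming (module +-*-Solver to ℚ-Solver)
open import Data.List using (List)
open import Data.Product using (Σ; _×_; proj₁; proj₂; _,_)
open import Data.Sum using (_⊎_; inj₁; inj₂; [_,_]′)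
open import Data.Empty using (⊥; ⊥-elim)
open import Function using (_∘_)
open import Relation.Nullary using (yes; no)
open import Relation.Binary.Definitions using (tri<; tri≈; tri>)
open import Relation.Binary.PropositionalEquality
open ≡-Reasoning

module _ where
  open ℤ-Solver

  +-minusˡ : ∀ i j → i ℤ.+ j ℤ.- i ≡ j
  +-minusˡ = solve 2 (λ i j → i :+ j :- i := j) refl

  +-minusʳ : ∀ i j → i ℤ.+ j ℤ.- j ≡ i
  +-minusʳ = solve 2 (λ i j → i :+ j :- j := i) refl

  window-length : ∀ N M n → (n ℤ.- M) ℤ.+ (N ℤ.+ M ℤ.- n ℤ.+ + 1) ≡ N ℤ.+ + 1
  window-length = solve 3 (λ N M n → (n :- M) :+ (N :+ M :- n :+ con (+ 1)) := N :+ con (+ 1)) refl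

+1≤⇒< : ∀ {i j} → i ℤ.+ + 1 ℤ.≤ j → i ℤ.< j
+1≤⇒< {i} = ℤP.suc[i]≤j⇒i<j ∘ subst (ℤ._≤ _) (ℤP.+-comm i (+ 1))

<⇒+1≤ : ∀ {i j} → i ℤ.< j → i ℤ.+ + 1 ℤ.≤ j
<⇒+1≤ {i} = subst (ℤ._≤ _) (ℤP.+-comm (+ 1) i) ∘ ℤP.i<j⇒suc[i]≤j

+-<⇒<-minus : ∀ i j n → i ℤ.+ j ℤ.< n → j ℤ.< n ℤ.- i
+-<⇒<-minus i j n i+j<n = subst (ℤ._< n ℤ.- i) (+-minusˡ i j) (ℤP.+-monoˡ-< (ℤ.- i) i+j<n)

trunc-nonNeg : ∀ {i} → + 0 ℤ.≤ i → + trunc i ≡ i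
trunc-nonNeg (+≤+ _) = refl

sumFrom-zero : ∀ h lo k → (∀ i → lo ℤ.≤ i → h i ≡ 0ℚ) → sumFrom h lo k ≡ 0ℚ
sumFrom-zero h lo zero    _   = refl
sumFrom-zero h lo (suc k) h≡0 =
  trans (cong₂ ℚ._+_ (h≡0 lo ℤP.≤-refl)
                     (sumFrom-zero h (lo ℤ.+ + 1) k (λ i lo+1≤i → h≡0 i (ℤP.≤-trans (ℤP.i≤i+j lo (+ 1)) lo+1≤i))))
        (ℚP.+-identityʳ 0ℚ)

sumFrom-single : ∀ h lo k j → lo ℤ.≤ j → j ℤ.< lo ℤ.+ + k → (∀ i → i ≢ j → h i ≡ 0ℚ) → sumFrom h lo k ≡ h j
sumFrom-single h lo zero    j lo≤j j<lo _ = ⊥-elim (ℤP.≤⇒≯ lo≤j (subst (j ℤ.<_) (ℤP.+-identityʳ lo) j<lo))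
sumFrom-single h lo (suc k) j lo≤j j<end h≡0 with lo ℤ.≟ j
... | yes refl =
  trans (cong (h lo ℚ.+_) (sumFrom-zero h (lo ℤ.+ + 1) k (λ i lo+1≤i → h≡0 i (ℤP.<⇒≢ (+1≤⇒< lo+1≤i) ∘ sym))))
        (ℚP.+-identityʳ (h lo))
... | no lo≢j =
  trans (cong₂ ℚ._+_ (h≡0 lo lo≢j)
                     (sumFrom-single h (lo ℤ.+ + 1) k j (<⇒+1≤ (ℤP.≤∧≢⇒< lo≤j lo≢j))
                                     (subst (j ℤ.<_) (sym (ℤP.+-assoc lo (+ 1) (+ k))) j<end) h≡0))
        (ℚP.+-identityˡ (h j))

BoundedBy-mono : ∀ {f p q} → p ℤ.≤ q → BoundedBy f p → BoundedBy f q
BoundedBy-mono p≤q f≤p n q<n = f≤p n (ℤP.≤-<-trans p≤q q<n)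

IsDegree⇒≤bound : ∀ {f d N} → IsDegree f d → BoundedBy f N → d ℤ.≤ N
IsDegree⇒≤bound (fd≢0 , _) f≤N = ℤP.≮⇒≥ (fd≢0 ∘ f≤N _)

cauchy-term-vanishes : ∀ {f g p q} i n → BoundedBy f p → BoundedBy g q
                     → p ℤ.< i ⊎ q ℤ.< n ℤ.- i → f i ℚ.* g (n ℤ.- i) ≡ 0ℚ
cauchy-term-vanishes {g = g} i n f≤p _ (inj₁ p<i) = trans (cong (ℚ._* g (n ℤ.- i)) (f≤p i p<i)) (ℚP.*-zeroˡ (g (n ℤ.- i)))
cauchy-term-vanishes {f = f} i n _ g≤q (inj₂ q<n-i) = trans (cong (f i ℚ.*_) (g≤q _ q<n-i)) (ℚP.*-zeroʳ (f i))

mul-bounded : ∀ f N g M {p q} → BoundedBy f p → BoundedBy g q → BoundedBy (mul f N g M) (p ℤ.+ q)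
mul-bounded f N g M {p} {q} f≤p g≤q n p+q<n =
  sumFrom-zero (λ i → f i ℚ.* g (n ℤ.- i)) (n ℤ.- M) (trunc (N ℤ.+ M ℤ.- n ℤ.+ + 1)) (λ i _ → cauchy-term-vanishes i n f≤p g≤q (outside i))
  where
  outside : ∀ i → p ℤ.< i ⊎ q ℤ.< n ℤ.- i
  outside i with p ℤP.<? i
  ... | yes p<i = inj₁ p<i
  ... | no  p≮i = inj₂ (+-<⇒<-minus i q n (ℤP.≤-<-trans (ℤP.+-monoˡ-≤ q (ℤP.≮⇒≥ p≮i)) p+q<n))

-- N and M only fix the summation window of the Cauchy sum; they must dominate p and q
-- for the top term to lie inside it.
mul-top : ∀ f N g M {p q} → BoundedBy f p → BoundedBy g q → p ℤ.≤ N → q ℤ.≤ M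
        → mul f N g M (p ℤ.+ q) ≡ f p ℚ.* g q
mul-top f N g M {p} {q} f≤p g≤q p≤N q≤M = begin
  mul f N g M n          ≡⟨ sumFrom-single _ (n ℤ.- M) _ p window-start window-end off-top ⟩
  f p ℚ.* g (n ℤ.- p)    ≡⟨ cong (λ j → f p ℚ.* g j) (+-minusˡ p q) ⟩
  f p ℚ.* g q            ∎
  where
  n : ℤ
  n = p ℤ.+ q

  window-start : n ℤ.- M ℤ.≤ p
  window-start = subst (n ℤ.- M ℤ.≤_) (+-minusʳ p M) (ℤP.+-monoˡ-≤ (ℤ.- M) (ℤP.+-monoʳ-≤ p q≤M))

  window-end : p ℤ.< (n ℤ.- M) ℤ.+ + trunc (N ℤ.+ M ℤ.- n ℤ.+ + 1)
  window-end = subst (p ℤ.<_) (sym (trans (cong (λ w → (n ℤ.- M) ℤ.+ w) (trunc-nonNeg window-nonNeg)) (window-length N M n)))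
                     (+1≤⇒< (ℤP.+-monoˡ-≤ (+ 1) p≤N))
    where
    window-nonNeg : + 0 ℤ.≤ N ℤ.+ M ℤ.- n ℤ.+ + 1
    window-nonNeg = ℤP.≤-trans (ℤP.i≤j⇒0≤j-i (ℤP.+-mono-≤ p≤N q≤M)) (ℤP.i≤i+j _ (+ 1))

  off-top : ∀ i → i ≢ p → f i ℚ.* g (n ℤ.- i) ≡ 0ℚ
  off-top i i≢p = cauchy-term-vanishes i n f≤p g≤q side
    where
    side : p ℤ.< i ⊎ q ℤ.< n ℤ.- i
    side with p ℤP.<? i
    ... | yes p<i = inj₁ p<i
    ... | no  p≮i = inj₂ (+-<⇒<-minus i q n (ℤP.+-monoˡ-< q (ℤP.≤∧≢⇒< (ℤP.≮⇒≥ p≮i) i≢p)))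

deriv-bounded : ∀ {f} m → BoundedBy f (+ suc m) → BoundedBy (deriv f) (+ m)
deriv-bounded {f} m f≤m+1 n m<n =
  trans (cong (ℤtoℚ (n ℤ.+ + 1) ℚ.*_)
              (f≤m+1 _ (subst (ℤ._< n ℤ.+ + 1) (cong +_ (ℕP.+-comm m 1)) (ℤP.+-monoˡ-< (+ 1) m<n))))
        (ℚP.*-zeroʳ (ℤtoℚ (n ℤ.+ + 1)))

deriv-at : ∀ f m → deriv f (+ m) ≡ ℤtoℚ (+ suc m) ℚ.* f (+ suc m)
deriv-at f m = cong (λ j → ℤtoℚ j ℚ.* f j) (cong +_ (ℕP.+-comm m 1))

*-cancelʳ-≢0 : ∀ {p q} r → r ≢ 0ℚ → p ℚ.* r ≡ q ℚ.* r → p ≡ q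
*-cancelʳ-≢0 {p} {q} r r≢0 pr≡qr = begin
  p                        ≡⟨ sym (divide-out p) ⟩
  p ℚ.* r ℚ.* ℚ.1/ r       ≡⟨ cong (ℚ._* ℚ.1/ r) pr≡qr ⟩
  q ℚ.* r ℚ.* ℚ.1/ r       ≡⟨ divide-out q ⟩
  q                        ∎
  where
  instance
    r≢0′ : NonZero r
    r≢0′ = ≢-nonZero r≢0

  divide-out : ∀ s → s ℚ.* r ℚ.* ℚ.1/ r ≡ s
  divide-out s = trans (ℚP.*-assoc s r _) (trans (cong (s ℚ.*_) (ℚP.*-inverseʳ r)) (ℚP.*-identityʳ s))

*-≢0 : ∀ {p q} → p ≢ 0ℚ → q ≢ 0ℚ → p ℚ.* q ≢ 0ℚ
*-≢0 {q = q} p≢0 q≢0 pq≡0 = p≢0 (*-cancelʳ-≢0 q q≢0 (trans pq≡0 (sym (ℚP.*-zeroˡ q))))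

*≡⇒≡÷ : ∀ {p q r} (r≢0 : r ≢ 0ℚ) → q ℚ.* r ≡ p → q ≡ _÷_ p r {{≢-nonZero r≢0}}
*≡⇒≡÷ {p} {q} {r} r≢0 qr≡p = sym (*-cancelʳ-≢0 r r≢0 (begin
  p ℚ.* ℚ.1/ r ℚ.* r       ≡⟨ ℚP.*-assoc p _ r ⟩
  p ℚ.* (ℚ.1/ r ℚ.* r)     ≡⟨ cong (p ℚ.*_) (ℚP.*-inverseˡ r) ⟩
  p ℚ.* 1ℚ                 ≡⟨ ℚP.*-identityʳ p ⟩
  p                        ≡⟨ sym qr≡p ⟩
  q ℚ.* r                  ∎))
  where
  instance
    r≢0′ : NonZero r
    r≢0′ = ≢-nonZero r≢0

module LeadingCoefficient
  (a b c d : ℤ → ℚ) (sb sc : ℕ)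
  (a≤sb : BoundedBy a (+ sb))
  (deg-b : IsDegree b (+ sb)) (deg-c : IsDegree c (+ sc)) (deg-d : IsDegree d (+ suc sb))
  (x : ℤ → ℚ) (N : ℤ) (x≤N : BoundedBy x N)
  (riccati : ∀ n → mul d (+ suc sb) (deriv x) N n
                   ≡ a n ℚ.+ mul b (+ sb) x N n ℚ.+ mul c (+ sc) (mul x N x N) (N ℤ.+ N) n)
  (m : ℕ) (deg-x : IsDegree x (+ suc m))
  where

  ℓ rb rc rd : ℚ
  ℓ  = x (+ suc m)
  rb = b (+ sb)
  rc = c (+ sc)
  rd = d (+ suc sb)

  lhs linear quadratic : ℤ → ℚ
  lhs       = mul d (+ suc sb) (deriv x) N
  linear    = mul b (+ sb) x N
  quadratic = mul c (+ sc) (mul x N x N) (N ℤ.+ N)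

  deg≤N : + suc m ℤ.≤ N
  deg≤N = IsDegree⇒≤bound deg-x x≤N

  lhs-index : + suc sb ℤ.+ + m ≡ + (sb ℕ.+ suc m)
  lhs-index = cong +_ (sym (ℕP.+-suc sb m))

  lhs-bounded : BoundedBy lhs (+ (sb ℕ.+ suc m))
  lhs-bounded = subst (BoundedBy lhs) lhs-index (mul-bounded d (+ suc sb) (deriv x) N (proj₂ deg-d) (deriv-bounded m (proj₂ deg-x)))

  lhs-top : lhs (+ (sb ℕ.+ suc m)) ≡ rd ℚ.* (ℤtoℚ (+ suc m) ℚ.* ℓ)
  lhs-top = begin
    lhs (+ (sb ℕ.+ suc m))   ≡⟨ cong lhs (sym lhs-index) ⟩
    lhs (+ suc sb ℤ.+ + m)   ≡⟨ mul-top d _ (deriv x) N (proj₂ deg-d) (deriv-bounded m (proj₂ deg-x))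
                                        ℤP.≤-refl (ℤP.≤-trans (+≤+ (ℕP.n≤1+n m)) deg≤N) ⟩
    rd ℚ.* deriv x (+ m)     ≡⟨ cong (rd ℚ.*_) (deriv-at x m) ⟩
    rd ℚ.* (ℤtoℚ (+ suc m) ℚ.* ℓ) ∎

  linear-bounded : BoundedBy linear (+ (sb ℕ.+ suc m))
  linear-bounded = mul-bounded b (+ sb) x N (proj₂ deg-b) (proj₂ deg-x)

  linear-top : linear (+ (sb ℕ.+ suc m)) ≡ rb ℚ.* ℓ
  linear-top = mul-top b _ x N (proj₂ deg-b) (proj₂ deg-x) ℤP.≤-refl deg≤N

  square-bounded : BoundedBy (mul x N x N) (+ (suc m ℕ.+ suc m))
  square-bounded = mul-bounded x N x N (proj₂ deg-x) (proj₂ deg-x)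

  quadratic-bounded : BoundedBy quadratic (+ (sc ℕ.+ (suc m ℕ.+ suc m)))
  quadratic-bounded = mul-bounded c (+ sc) (mul x N x N) (N ℤ.+ N) (proj₂ deg-c) square-bounded

  quadratic-top : quadratic (+ (sc ℕ.+ (suc m ℕ.+ suc m))) ≡ rc ℚ.* (ℓ ℚ.* ℓ)
  quadratic-top = trans (mul-top c _ (mul x N x N) _ (proj₂ deg-c) square-bounded ℤP.≤-refl (ℤP.+-mono-≤ deg≤N deg≤N))
                        (cong (rc ℚ.*_) (mul-top x N x N (proj₂ deg-x) (proj₂ deg-x) deg≤N deg≤N))

  riccati-at : ∀ n {l α β γ} → lhs n ≡ l → a n ≡ α → linear n ≡ β → quadratic n ≡ γ → l ≡ α ℚ.+ β ℚ.+ γ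
  riccati-at n l≡ α≡ β≡ γ≡ = trans (sym l≡) (trans (riccati n) (cong₂ ℚ._+_ (cong₂ ℚ._+_ α≡ β≡) γ≡))

  a-below-top : a (+ (sb ℕ.+ suc m)) ≡ 0ℚ
  a-below-top = a≤sb _ (+<+ (ℕP.m<m+n sb (s≤s z≤n)))

  shift-by-degree : ∀ {i j} → i ℕ.< j → i ℕ.+ suc m ℕ.< j ℕ.+ suc m
  shift-by-degree = ℕP.+-monoˡ-< (suc m)

  twice : sc ℕ.+ suc m ℕ.+ suc m ≡ sc ℕ.+ (suc m ℕ.+ suc m)
  twice = ℕP.+-assoc sc (suc m) (suc m)

  quadratic-dominates : sb ℕ.< sc ℕ.+ suc m → ⊥
  quadratic-dominates sb<sc+m = *-≢0 (proj₁ deg-c) (*-≢0 (proj₁ deg-x) (proj₁ deg-x)) (sym (begin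
    0ℚ                                ≡⟨ riccati-at n (lhs-bounded n top<n) (a≤sb n (ℤP.<-trans (+<+ (ℕP.m<m+n sb (s≤s z≤n))) top<n))
                                                    (linear-bounded n top<n) quadratic-top ⟩
    0ℚ ℚ.+ 0ℚ ℚ.+ rc ℚ.* (ℓ ℚ.* ℓ)    ≡⟨ solve 1 (λ z → con 0ℚ :+ con 0ℚ :+ z := z) refl _ ⟩
    rc ℚ.* (ℓ ℚ.* ℓ)                  ∎))
    where
    open ℚ-Solver
    n : ℤ
    n = + (sc ℕ.+ (suc m ℕ.+ suc m))
    top<n : + (sb ℕ.+ suc m) ℤ.< n
    top<n = +<+ (subst (sb ℕ.+ suc m ℕ.<_) twice (shift-by-degree sb<sc+m))

  linear-dominates : sc ℕ.+ suc m ℕ.< sb → ℤtoℚ (+ suc m) ℚ.* rd ≡ rb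
  linear-dominates sc+m<sb = *-cancelʳ-≢0 ℓ (proj₁ deg-x) (begin
    ℤtoℚ (+ suc m) ℚ.* rd ℚ.* ℓ       ≡⟨ solve 3 (λ μ r z → μ :* r :* z := r :* (μ :* z)) refl (ℤtoℚ (+ suc m)) rd ℓ ⟩
    rd ℚ.* (ℤtoℚ (+ suc m) ℚ.* ℓ)     ≡⟨ riccati-at n lhs-top a-below-top linear-top (quadratic-bounded n quadratic<n) ⟩
    0ℚ ℚ.+ rb ℚ.* ℓ ℚ.+ 0ℚ            ≡⟨ solve 1 (λ z → con 0ℚ :+ z :+ con 0ℚ := z) refl _ ⟩
    rb ℚ.* ℓ                          ∎)
    where
    open ℚ-Solver
    n : ℤ
    n = + (sb ℕ.+ suc m)
    quadratic<n : + (sc ℕ.+ (suc m ℕ.+ suc m)) ℤ.< n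
    quadratic<n = +<+ (subst (ℕ._< sb ℕ.+ suc m) twice (shift-by-degree sc+m<sb))

  balanced : sc ℕ.+ suc m ≡ sb → ℓ ≡ _÷_ (rd ℚ.* ℤtoℚ (+ suc m) ℚ.- rb) rc {{≢-nonZero (proj₁ deg-c)}}
  balanced sc+m≡sb = *≡⇒≡÷ (proj₁ deg-c) (begin
    ℓ ℚ.* rc                          ≡⟨ solve 3 (λ r s z → z :* s := r :+ z :* s :- r) refl rb rc ℓ ⟩
    rb ℚ.+ ℓ ℚ.* rc ℚ.- rb            ≡⟨ cong (ℚ._- rb) top-coefficients ⟩
    rd ℚ.* ℤtoℚ (+ suc m) ℚ.- rb      ∎)
    where
    open ℚ-Solver
    quadratic-at-top : quadratic (+ (sb ℕ.+ suc m)) ≡ rc ℚ.* (ℓ ℚ.* ℓ)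
    quadratic-at-top = trans (cong (λ j → quadratic (+ j)) (trans (cong (ℕ._+ suc m) (sym sc+m≡sb)) twice)) quadratic-top
    top-coefficients : rb ℚ.+ ℓ ℚ.* rc ≡ rd ℚ.* ℤtoℚ (+ suc m)
    top-coefficients = *-cancelʳ-≢0 ℓ (proj₁ deg-x) (sym (begin
      rd ℚ.* ℤtoℚ (+ suc m) ℚ.* ℓ             ≡⟨ ℚP.*-assoc rd _ ℓ ⟩
      rd ℚ.* (ℤtoℚ (+ suc m) ℚ.* ℓ)           ≡⟨ riccati-at _ lhs-top a-below-top linear-top quadratic-at-top ⟩
      0ℚ ℚ.+ rb ℚ.* ℓ ℚ.+ rc ℚ.* (ℓ ℚ.* ℓ)    ≡⟨ solve 3 (λ r s z → con 0ℚ :+ r :* z :+ s :* (z :* z) := (r :+ z :* s) :* z) refl rb rc ℓ ⟩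
      (rb ℚ.+ ℓ ℚ.* rc) ℚ.* ℓ                 ∎))

  degree-and-leading-coefficient
    : sc ℕ.< sb
    → (∀ k → 0 ℕ.< k → k ℕ.< 2 ℕ.* (sb ∸ sc) → ℤtoℚ (+ k) ℚ.* rd ≢ rb)
    → IsDegree x (+ (sb ∸ sc))
      × x (+ (sb ∸ sc)) ≡ _÷_ (rd ℚ.* ℤtoℚ (+ (sb ∸ sc)) ℚ.- rb) rc {{≢-nonZero (proj₁ deg-c)}}
  degree-and-leading-coefficient sc<sb nonresonant with ℕP.<-cmp (sc ℕ.+ suc m) sb
  ... | tri< sc+m<sb _ _ = ⊥-elim (nonresonant (suc m) (s≤s z≤n) m<2k (linear-dominates sc+m<sb))
    where
    m<2k : suc m ℕ.< 2 ℕ.* (sb ∸ sc)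
    m<2k = ℕP.<-≤-trans (subst (ℕ._< sb ∸ sc) (ℕP.m+n∸m≡n sc (suc m)) (ℕP.∸-monoˡ-< sc+m<sb (ℕP.m≤m+n sc (suc m))))
                        (ℕP.m≤n*m (sb ∸ sc) 2)
  ... | tri≈ _ sc+m≡sb _ =
    subst (λ k → IsDegree x (+ k) × x (+ k) ≡ _÷_ (rd ℚ.* ℤtoℚ (+ k) ℚ.- rb) rc {{≢-nonZero (proj₁ deg-c)}})
          (trans (sym (ℕP.m+n∸m≡n sc (suc m))) (cong (_∸ sc) sc+m≡sb))
          (deg-x , balanced sc+m≡sb)
  ... | tri> _ _ sb<sc+m = ⊥-elim (quadratic-dominates sb<sc+m)

lemma4 : (A B C D : List ℚ) (sb sc sd : ℕ)
    → (∀ n → coeffP A n ≡ 0ℚ) ⊎ Σ ℕ (λ sa → IsDegree (coeffP A) (+ sa) × sa ℕ.≤ sb)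
    → (hB : IsDegree (coeffP B) (+ sb))
    → (hC : IsDegree (coeffP C) (+ sc))
    → (hD : IsDegree (coeffP D) (+ sd))
    → sd ≡ suc sb
    → sc ℕ.< sb
    → (∀ (d : ℕ) → 0 ℕ.< d → d ℕ.< 2 ℕ.* (sb ∸ sc)
         → ℤtoℚ (+ d) ℚ.* coeffP D (+ sd) ≢ coeffP B (+ sb))
    → (x : ℤ → ℚ) (N : ℤ) → BoundedBy x N
    → (∀ n → mul (coeffP D) (+ sd) (deriv x) N n
             ≡ coeffP A n ℚ.+ mul (coeffP B) (+ sb) x N n
                 ℚ.+ mul (coeffP C) (+ sc) (mul x N x N) (N ℤ.+ N) n)
    → Σ ℤ (λ dx → IsDegree x dx × + 1 ℤ.≤ dx)
    → IsDegree x (+ (sb ∸ sc))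
      × x (+ (sb ∸ sc))
        ≡ _÷_ (coeffP D (+ sd) ℚ.* ℤtoℚ (+ (sb ∸ sc)) ℚ.- coeffP B (+ sb))
              (coeffP C (+ sc)) {{≢-nonZero (proj₁ hC)}}
lemma4 A B C D sb sc _ hA hB hC hD refl sc<sb nonresonant x N x≤N riccati (+ suc m , deg-x , _) =
  LeadingCoefficient.degree-and-leading-coefficient
    (coeffP A) (coeffP B) (coeffP C) (coeffP D) sb sc A≤sb hB hC hD x N x≤N riccati m deg-x sc<sb nonresonant
  where
  A≤sb : BoundedBy (coeffP A) (+ sb)
  A≤sb = [ (λ A≡0 n _ → A≡0 n) , (λ (_ , deg-A , sa≤sb) → BoundedBy-mono (+≤+ sa≤sb) (proj₂ deg-A)) ]′ hA
lemma4 _ _ _ _ _ _ _ _ _ _ _ _ _ _ _ _ _ _ (+ zero , _ , +≤+ ())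
lemma4 _ _ _ _ _ _ _ _ _ _ _ _ _ _ _ _ _ _ (-[1+ _ ] , _ , ())
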